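{- Let $\mathcal R=(\mathcal F,\Pi,\mu,E,H,R)$ be an EGTRS, $\alpha:\ell\to r\Leftarrow c\in R^{rm}$ and $\beta:\lambda\to\rho\Leftarrow\gamma\in\overleftrightarrow E$. (1) For $x\in\mathcal{V}ar^\mu(\lambda)$, $p\in\mathcal{P}os^\mu_x(\lambda)$ and fresh $x'$, let $\pi^{\to}_{\beta,x,p}$ be $\langle\lambda[x']_p,\rho\rangle\Leftarrow x\to x',\gamma$. If $\beta$ is left-$\mu$-homogeneous and $\mu$-compatible, then $\pi^{\to}_{\beta,x,p}$ is joinable modulo $E$ w.r.t. $\to_{\mathcal R}$; furthermore (a) if $x$ occurs more than once in $\lambda$, it is left-strictly joinable modulo $E$ w.r.t. $\to_{\mathcal R}$, and (b) if $x\in\mathcal{V}ar(\rho)$, it is right-strictly joinable modulo $E$ w.r.t. $\to_{\mathcal R}$. (2) For $x\in\mathcal{V}ar^\mu(\ell)$, $p\in\mathcal{P}os^\mu_x(\ell)$ and fresh $x'$, let $\pi^{\leftrightarrow}_{\alpha,x,p}$ be $\langle\ell[x']_p,r\rangle\Leftarrow x\leftrightarrow x',c$. If $\alpha$ is left-$\mu$-homogeneous and $\mu$-compatible, then $\pi^{\leftrightarrow}_{\alpha,x,p}$ is left-strictly joinable modulo $E$ w.r.t. $\to_{\mathcal R,E}$; furthermore, if $\alpha$ is also $\mu$-left-linear, then it is left-strictly joinable modulo $E$ w.r.t. $\to_{\mathcal R}$.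
   Context: Terms over a signature $\mathcal F$ and countable variables $\mathcal X$. A replacement map $\mu$ assigns to each $k$-ary $f$ a set $\mu(f)\subseteq\{1,..,k\}$; active positions: $\mathcal{P}os^\mu(x)=\{\Lambda\}$, $\mathcal{P}os^\mu(f(t_1,..,t_k))=\{\Lambda\}\cup\{i.q\mid i\in\mu(f),q\in\mathcal{P}os^\mu(t_i)\}$; $\mathcal{P}os^\mu_x(t)$ the active positions of $x$; $\mathcal{V}ar^\mu(t)$ (resp. $\overline{\mathcal{V}ar}^\mu(t)$) the variables with an active (resp. non-active) occurrence; $\mathcal{V}ar(t)$ all variables. A term is $\mu$-homogeneous if $\mathcal{V}ar^\mu(t)\cap\overline{\mathcal{V}ar}^\mu(t)=\emptyset$, $\mu$-linear if no active variable occurs twice in it. A rule $\ell\to r\Leftarrow c$ is left-$\mu$-homogeneous (resp. $\mu$-left-linear) if $\ell$ is $\mu$-homogeneous (resp. $\mu$-linear), and $\mu$-compatible if $\mathcal{V}ar^\mu(\ell)\cap\overline{\mathcal{V}ar}^\mu(r)=\emptyset$ and no variable of $\mathcal{V}ar^\mu(\ell)$ occurs in $c$. An EGTRS is $\mathcal R=(\mathcal F,\Pi,\mu,E,H,R)$ with $\Pi$ a predicate signature containing binary $=,\to,\to^*$; $E$ conditional equations $s=t\Leftarrow c$; $H$ definite Horn clauses $A\Leftarrow c$ with head predicate not $=,\to,\to^*$; $R$ rules $\ell\to r\Leftarrow c$, $\ell\notin\mathcal X$; each $c$ a finite sequence of atoms; it is assumed that $=$ does not depend on $R$ (a predicate $P$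 depends on $R$ if $P\in\{\to,\to^*\}$ or some clause of $E\cup H$ with head predicate $P$ has a body atom whose predicate depends on $R$). $\overleftrightarrow E=\{s\to t\Leftarrow c,\ t\to s\Leftarrow c\mid s=t\Leftarrow c\in E\}$ (left-hand sides may be variables). $R^{rm}$: $R$ with $\approx$ replaced by new $\approx_{rm}$; $H^{rm}$: $H$ with $\approx,\to,\to^*$ replaced by new $\approx_{rm},\to_{rm},\to^*_{rm}$. $\mathsf{Th}^{CR}$: universal closures of (a) reflexivity, symmetry, transitivity of $=$, $x_i=y_i\Rightarrow f(..x_i..)=f(..y_i..)$ ($i\in\mu(f)$), $A_1\wedge..\wedge A_n\Rightarrow s=t$ for equations of $E$; (b) $x\to^*x$, $x\to y\wedge y\to^*z\Rightarrow x\to^*z$, $x_i\to y_i\Rightarrow f(..x_i..)\to f(..y_i..)$ ($i\in\mu(f)$), $A_1\wedge..\wedge A_n\Rightarrow\ell\to r$ for rules of $R^{rm}$; (c) $x\to^*_{ps}x$, $x\to_{ps}y\wedge y\to^*_{ps}z\Rightarrow x\to^*_{ps}z$, $\to_{ps}$-propagation for $i\in\mu(f)$, $x=\ell\wedge A_1\wedge..\wedge A_n\Rightarrow x\to_{ps}r$ ($x$ fresh) for rules of $R^{rm}$; (d) $x\to^*_{rm}x$, $x\to_{rm}y\wedge y\to^*_{rm}z\Rightarrow x\to^*_{rm}z$, $x=x'\wedge x'\to y'\wedge y'=y\Rightarrow x\to_{rm}y$; (e) the clauses of $H^{rm}$. $s\to_{\mathcal R}t$ / $s\to_{\mathcal R,E}t$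 iff $s\to t$ / $s\to_{ps}t$ is deducible from $\mathsf{Th}^{CR}$; $s=_Et$ iff $s=t$ is deducible from (a) plus the clauses of $H$; $s\leftrightarrow_Et$ iff $s\to t$ is deducible from the theory of $x\to^*x$, $x\to y\wedge y\to^*z\Rightarrow x\to^*z$, $\to$-propagation for $i\in\mu(f)$, and $A_1\wedge..\wedge A_n\Rightarrow\lambda\to\rho$ for each $\lambda\to\rho\Leftarrow A_1,..,A_n\in\overleftrightarrow E$. For a relation $\Rightarrow$ among $\to_{\mathcal R},\to_{\mathcal R,E}$: a conditional pair $\langle s,t\rangle\Leftarrow A_1,..,A_n$ is joinable modulo $E$ w.r.t. $\Rightarrow$ if for every substitution $\sigma$ satisfying all $A_i$ (i.e. $\sigma(A_i)$ deducible from $\mathsf{Th}^{CR}$, with atoms $u\leftrightarrow v$ satisfied iff $\sigma(u)\leftrightarrow_E\sigma(v)$) there are $u,u'$ with $\sigma(s)\Rightarrow^*u$, $\sigma(t)\Rightarrow^*u'$, $u=_Eu'$; left-strictly (resp. right-strictly) if moreover $\sigma(s)\Rightarrow^+u$ (resp. $\sigma(t)\Rightarrow^+u'$). -}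

module Defs where

open import Data.Nat using (ℕ; zero; suc)
open import Data.Fin using (Fin; toℕ)
open import Data.Fin.Subset using (Subset) renaming (_∈_ to _∈ₛ_)
open import Data.Vec using (Vec; []; _∷_; lookup; tabulate; _[_]≔_)
open import Data.List using (List; []; _∷_; map)
open import Data.List.Membership.Propositional using (_∈_)
open import Data.List.Relation.Unary.All using (All)
open import Data.List.Relation.Unary.Any using (Any)
open import Data.List.Relation.Binary.Pointwise using (Pointwise)
open import Data.Product using (Σ; ∃; ∃₂; _×_; _,_)
open import Data.Sum using (_⊎_)
open import Relation.Nullary using (¬_)
open import Relation.Binary.PropositionalEquality using (_≡_; _≢_)
open import Relation.Binary.Construct.Closure.ReflexiveTransitive using (Star)
open import Relation.Binary.Construct.Closure.Transitive using (TransClosure)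

-- Signatures: function symbols F with arities, and the predicate
-- symbols of Π other than the distinguished binary =, →, →*.

record Sig : Set₁ where
  field
    F   : Set
    ar  : F → ℕ
    P   : Set
    arP : P → ℕ
open Sig public

data Term (S : Sig) : Set where
  var : ℕ → Term S
  fun : (f : F S) → Vec (Term S) (ar S f) → Term S

-- Replacement map: μ(f) ⊆ {1..ar f} (indices 0-based here)
RMap : Sig → Set
RMap S = (f : F S) → Subset (ar S f)

Subst : Sig → Set
Subst S = ℕ → Term S

-- Positions: sequences of (0-based) argument indices; Λ = []
Pos : Set
Pos = List ℕ

module _ {S : Sig} where

  mutual
    _·_ : Subst S → Term S → Term S
    σ · var x    = σ x
    σ · fun f ts = fun f (σ ·* ts)

    _·*_ : ∀ {n} → Subst S → Vec (Term S) n → Vec (Term S) n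
    σ ·* []       = []
    σ ·* (t ∷ ts) = (σ · t) ∷ (σ ·* ts)

  data SubtermAt : Term S → Pos → Term S → Set where
    root : ∀ {t} → SubtermAt t [] t
    arg  : ∀ {f ts p u} (i : Fin (ar S f)) →
           SubtermAt (lookup ts i) p u → SubtermAt (fun f ts) (toℕ i ∷ p) u

  data APos (μ : RMap S) : Term S → Pos → Set where
    root : ∀ {t} → APos μ t []
    arg  : ∀ {f ts p} (i : Fin (ar S f)) → i ∈ₛ μ f →
           APos μ (lookup ts i) p → APos μ (fun f ts) (toℕ i ∷ p)

  mutual
    replace : Term S → Pos → Term S → Term S
    replace t          []      s = s
    replace (var x)    (_ ∷ _) s = var x
    replace (fun f ts) (i ∷ p) s = fun f (replaceArg ts i p s)

    replaceArg : ∀ {n} → Vec (Term S) n → ℕ → Pos → Term S → Vec (Term S) n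
    replaceArg []       i       p s = []
    replaceArg (t ∷ ts) zero    p s = replace t p s ∷ ts
    replaceArg (t ∷ ts) (suc i) p s = t ∷ replaceArg ts i p s

  PosVarA : RMap S → ℕ → Term S → Pos → Set
  PosVarA μ x t p = APos μ t p × SubtermAt t p (var x)

  VarT : Term S → ℕ → Set
  VarT t x = ∃ λ p → SubtermAt t p (var x)

  VarA : RMap S → Term S → ℕ → Set
  VarA μ t x = ∃ λ p → PosVarA μ x t p

  VarN : RMap S → Term S → ℕ → Set
  VarN μ t x = ∃ λ p → SubtermAt t p (var x) × ¬ APos μ t p

  μHomogeneous : RMap S → Term S → Set
  μHomogeneous μ t = ∀ x → VarA μ t x → ¬ VarN μ t x

  μLinear : RMap S → Term S → Set
  μLinear μ t = ∀ x → VarA μ t x → ∀ p q →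
    SubtermAt t p (var x) → SubtermAt t q (var x) → p ≡ q

  OccursMoreThanOnce : ℕ → Term S → Set
  OccursMoreThanOnce x t = ∃₂ λ p q → p ≢ q ×
    SubtermAt t p (var x) × SubtermAt t q (var x)

data ΠPred (S : Sig) : Set where
  eqΠ rwΠ rwsΠ : ΠPred S
  usrΠ : P S → ΠPred S

data CAtom (S : Sig) : Set where
  _≐_ _⇝_ _⇝*_ : Term S → Term S → CAtom S
  papp : (p : P S) → Vec (Term S) (arP S p) → CAtom S

predOf : ∀ {S} → CAtom S → ΠPred S
predOf (_ ≐ _)    = eqΠ
predOf (_ ⇝ _)    = rwΠ
predOf (_ ⇝* _)   = rwsΠ
predOf (papp p _) = usrΠ p

-- Atoms of the theory Th^CR (including the new predicates
-- →ps, →*ps, →rm, →*rm and P_rm)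
data TAtom (S : Sig) : Set where
  eqT rwT rwsT rwpsT rwspsT rwrmT rwsrmT : Term S → Term S → TAtom S
  pT pTrm : (p : P S) → Vec (Term S) (arP S p) → TAtom S

plain : ∀ {S} → CAtom S → TAtom S
plain (s ≐ t)     = eqT s t
plain (s ⇝ t)     = rwT s t
plain (s ⇝* t)    = rwsT s t
plain (papp p ts) = pT p ts

module _ {S : Sig} where

  _·A_ : Subst S → TAtom S → TAtom S
  σ ·A eqT s t    = eqT (σ · s) (σ · t)
  σ ·A rwT s t    = rwT (σ · s) (σ · t)
  σ ·A rwsT s t   = rwsT (σ · s) (σ · t)
  σ ·A rwpsT s t  = rwpsT (σ · s) (σ · t)
  σ ·A rwspsT s t = rwspsT (σ · s) (σ · t)
  σ ·A rwrmT s t  = rwrmT (σ · s) (σ · t)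
  σ ·A rwsrmT s t = rwsrmT (σ · s) (σ · t)
  σ ·A pT p ts    = pT p (σ ·* ts)
  σ ·A pTrm p ts  = pTrm p (σ ·* ts)

  argsV : ∀ {n} → Vec (Term S) n → List (Term S)
  argsV []       = []
  argsV (t ∷ ts) = t ∷ argsV ts

  argsT : TAtom S → List (Term S)
  argsT (eqT s t)    = s ∷ t ∷ []
  argsT (rwT s t)    = s ∷ t ∷ []
  argsT (rwsT s t)   = s ∷ t ∷ []
  argsT (rwpsT s t)  = s ∷ t ∷ []
  argsT (rwspsT s t) = s ∷ t ∷ []
  argsT (rwrmT s t)  = s ∷ t ∷ []
  argsT (rwsrmT s t) = s ∷ t ∷ []
  argsT (pT p ts)    = argsV ts
  argsT (pTrm p ts)  = argsV ts

  VarCond : List (TAtom S) → ℕ → Set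
  VarCond c x = Any (λ A → Any (λ t → VarT t x) (argsT A)) c

record CEqn (S : Sig) : Set where
  constructor _≐_⇐_
  field
    lhs rhs : Term S
    cond    : List (CAtom S)

record HClause (S : Sig) : Set where
  constructor hclause
  field
    hp    : P S
    hargs : Vec (Term S) (arP S hp)
    body  : List (CAtom S)

record CRule (S : Sig) : Set where
  constructor _⇝_⇐_
  field
    lhs rhs : Term S
    cond    : List (CAtom S)

data DependsR {S : Sig} (E : CEqn S → Set) (H : HClause S → Set) :
     ΠPred S → Set where
  dep-rw  : DependsR E H rwΠ
  dep-rws : DependsR E H rwsΠ
  dep-E   : ∀ {e} → E e → ∀ {A} → A ∈ CEqn.cond e →
            DependsR E H (predOf A) → DependsR E H eqΠ
  dep-H   : ∀ {h} → H h → ∀ {A} → A ∈ HClause.body h →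
            DependsR E H (predOf A) → DependsR E H (usrΠ (HClause.hp h))

record EGTRS (S : Sig) : Set₁ where
  field
    μ : RMap S
    E : CEqn S → Set
    H : HClause S → Set
    R : CRule S → Set
    R-lhs-nonvar : ∀ {ρ} → R ρ → ∀ x → CRule.lhs ρ ≢ var x
    eq-indep : ¬ DependsR E H eqΠ

-- The "rm" renaming: predicates depending on R get replaced by new ones

module _ {S : Sig} (ℛ : EGTRS S) where
  open EGTRS ℛ

  data RmAtom : CAtom S → TAtom S → Set where
    rm-eq   : ∀ {s t} → RmAtom (s ≐ t) (eqT s t)
    rm-rw   : ∀ {s t} → RmAtom (s ⇝ t) (rwrmT s t)
    rm-rws  : ∀ {s t} → RmAtom (s ⇝* t) (rwsrmT s t)
    rm-dep  : ∀ {p ts} → DependsR E H (usrΠ p) → RmAtom (papp p ts) (pTrm p ts)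
    rm-ndep : ∀ {p ts} → ¬ DependsR E H (usrΠ p) → RmAtom (papp p ts) (pT p ts)

  InRrm : Term S → Term S → List (TAtom S) → Set
  InRrm l r c = ∃ λ c₀ → R (l ⇝ r ⇐ c₀) × Pointwise RmAtom c₀ c

  data InSymE : Term S → Term S → List (CAtom S) → Set where
    fwd : ∀ {s t c} → E (s ≐ t ⇐ c) → InSymE s t c
    bwd : ∀ {s t c} → E (s ≐ t ⇐ c) → InSymE t s c

record Clause (S : Sig) : Set where
  constructor _⇐ᶜ_
  field
    head : TAtom S
    body : List (TAtom S)

data _⊢_ {S : Sig} (T : Clause S → Set) : TAtom S → Set where
  inst : ∀ {h b} → T (h ⇐ᶜ b) → (σ : Subst S) →
         All (T ⊢_) (map (σ ·A_) b) → T ⊢ (σ ·A h)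

module _ {S : Sig} (ℛ : EGTRS S) where
  open EGTRS ℛ

  private
    v : ℕ → Term S
    v = var
    xs : (f : F S) → Vec (Term S) (ar S f)
    xs f = tabulate (λ j → var (toℕ j))
    -- f(x1..xk) and f(x1..y_i..xk) with y_i the variable ar f
    congPair : (f : F S) → Fin (ar S f) → Term S × Term S
    congPair f i = fun f (xs f) , fun f (xs f [ i ]≔ var (ar S f))

  data ThA : Clause S → Set where
    eq-refl  : ThA (eqT (v 0) (v 0) ⇐ᶜ [])
    eq-sym   : ThA (eqT (v 1) (v 0) ⇐ᶜ (eqT (v 0) (v 1) ∷ []))
    eq-trans : ThA (eqT (v 0) (v 2) ⇐ᶜ (eqT (v 0) (v 1) ∷ eqT (v 1) (v 2) ∷ []))
    eq-cong  : ∀ f (i : Fin (ar S f)) → i ∈ₛ μ f →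
               ThA (eqT (Data.Product.proj₁ (congPair f i)) (Data.Product.proj₂ (congPair f i))
                    ⇐ᶜ (eqT (var (toℕ i)) (var (ar S f)) ∷ []))
    eq-E     : ∀ {s t c} → E (s ≐ t ⇐ c) → ThA (eqT s t ⇐ᶜ map plain c)

  data ThCR : Clause S → Set where
    a        : ∀ {cl} → ThA cl → ThCR cl
    rws-refl : ThCR (rwsT (v 0) (v 0) ⇐ᶜ [])
    rws-step : ThCR (rwsT (v 0) (v 2) ⇐ᶜ (rwT (v 0) (v 1) ∷ rwsT (v 1) (v 2) ∷ []))
    rw-cong  : ∀ f (i : Fin (ar S f)) → i ∈ₛ μ f →
               ThCR (rwT (Data.Product.proj₁ (congPair f i)) (Data.Product.proj₂ (congPair f i))
                     ⇐ᶜ (rwT (var (toℕ i)) (var (ar S f)) ∷ []))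
    rw-rule  : ∀ {l r c} → InRrm ℛ l r c → ThCR (rwT l r ⇐ᶜ c)
    rwsps-refl : ThCR (rwspsT (v 0) (v 0) ⇐ᶜ [])
    rwsps-step : ThCR (rwspsT (v 0) (v 2) ⇐ᶜ (rwpsT (v 0) (v 1) ∷ rwspsT (v 1) (v 2) ∷ []))
    rwps-cong  : ∀ f (i : Fin (ar S f)) → i ∈ₛ μ f →
               ThCR (rwpsT (Data.Product.proj₁ (congPair f i)) (Data.Product.proj₂ (congPair f i))
                     ⇐ᶜ (rwpsT (var (toℕ i)) (var (ar S f)) ∷ []))
    rwps-rule : ∀ {l r c} → InRrm ℛ l r c → ∀ x →
               ¬ VarT l x → ¬ VarT r x → ¬ VarCond c x →
               ThCR (rwpsT (var x) r ⇐ᶜ (eqT (var x) l ∷ c))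
    rwsrm-refl : ThCR (rwsrmT (v 0) (v 0) ⇐ᶜ [])
    rwsrm-step : ThCR (rwsrmT (v 0) (v 2) ⇐ᶜ (rwrmT (v 0) (v 1) ∷ rwsrmT (v 1) (v 2) ∷ []))
    rwrm-def   : ThCR (rwrmT (v 0) (v 3) ⇐ᶜ
                      (eqT (v 0) (v 1) ∷ rwT (v 1) (v 2) ∷ eqT (v 2) (v 3) ∷ []))
    h-rm     : ∀ {p ts b hd b'} → H (hclause p ts b) →
               RmAtom ℛ (papp p ts) hd → Pointwise (RmAtom ℛ) b b' →
               ThCR (hd ⇐ᶜ b')

  data ThEq : Clause S → Set where
    a   : ∀ {cl} → ThA cl → ThEq cl
    h   : ∀ {p ts b} → H (hclause p ts b) → ThEq (pT p ts ⇐ᶜ map plain b)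

  data ThSym : Clause S → Set where
    rws-refl : ThSym (rwsT (v 0) (v 0) ⇐ᶜ [])
    rws-step : ThSym (rwsT (v 0) (v 2) ⇐ᶜ (rwT (v 0) (v 1) ∷ rwsT (v 1) (v 2) ∷ []))
    rw-cong  : ∀ f (i : Fin (ar S f)) → i ∈ₛ μ f →
               ThSym (rwT (Data.Product.proj₁ (congPair f i)) (Data.Product.proj₂ (congPair f i))
                      ⇐ᶜ (rwT (var (toℕ i)) (var (ar S f)) ∷ []))
    rw-E     : ∀ {l r c} → InSymE ℛ l r c → ThSym (rwT l r ⇐ᶜ map plain c)

  _→R_ : Term S → Term S → Set
  s →R t = ThCR ⊢ rwT s t

  _→RE_ : Term S → Term S → Set
  s →RE t = ThCR ⊢ rwpsT s t

  _=E_ : Term S → Term S → Set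
  s =E t = ThEq ⊢ eqT s t

  _↔E_ : Term S → Term S → Set
  s ↔E t = ThSym ⊢ rwT s t

data PAtom (S : Sig) : Set where
  th  : TAtom S → PAtom S
  _↔_ : Term S → Term S → PAtom S

record CPair (S : Sig) : Set where
  constructor ⟨_,_⟩⇐_
  field
    lhs rhs : Term S
    cond    : List (PAtom S)

module _ {S : Sig} (ℛ : EGTRS S) where

  Sat : Subst S → PAtom S → Set
  Sat σ (th A)  = ThCR ℛ ⊢ (σ ·A A)
  Sat σ (s ↔ t) = _↔E_ ℛ (σ · s) (σ · t)

  JoinWith : (Term S → Term S → Set) → (Term S → Term S → Set) →
             (Term S → Term S → Set) → CPair S → Set
  JoinWith _⇒_ L Rr (⟨ s , t ⟩⇐ c) = ∀ (σ : Subst S) → All (Sat σ) c →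
    ∃₂ λ u u' → L (σ · s) u × Rr (σ · t) u' × _=E_ ℛ u u'

  Joinable : (Term S → Term S → Set) → CPair S → Set
  Joinable _⇒_ = JoinWith _⇒_ (Star _⇒_) (Star _⇒_)

  LeftStrictlyJoinable : (Term S → Term S → Set) → CPair S → Set
  LeftStrictlyJoinable _⇒_ = JoinWith _⇒_ (TransClosure _⇒_) (Star _⇒_)

  RightStrictlyJoinable : (Term S → Term S → Set) → CPair S → Set
  RightStrictlyJoinable _⇒_ = JoinWith _⇒_ (Star _⇒_) (TransClosure _⇒_)

  μCompatible : Term S → Term S → List (TAtom S) → Set
  μCompatible l r c =
    (∀ x → VarA (EGTRS.μ ℛ) l x → ¬ VarN (EGTRS.μ ℛ) r x) ×
    (∀ x → VarA (EGTRS.μ ℛ) l x → ¬ VarCond c x)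

  FreshFor : ℕ → Term S → Term S → List (TAtom S) → Set
  FreshFor x' l r c = ¬ VarT l x' × ¬ VarT r x' × ¬ VarCond c x'

  πRw : Term S → Term S → List (CAtom S) → ℕ → Pos → ℕ → CPair S
  πRw lam rho γ x p x' =
    ⟨ replace lam p (var x') , rho ⟩⇐ (th (rwT (var x) (var x')) ∷ map (λ A → th (plain A)) γ)

  πSym : Term S → Term S → List (TAtom S) → ℕ → Pos → ℕ → CPair S
  πSym l r c x p x' =
    ⟨ replace l p (var x') , r ⟩⇐ ((var x ↔ var x') ∷ map th c)

-- Write τ = σ[x ↦ σ x'].
--
-- (1) Let σ satisfy x → x' and γ.  By μ-homogeneity of λ and μ-compatibility of β every
-- occurrence of x in λ[x']_p and in ρ is active, so rewriting them all gives
-- σ(λ[x']_p) →* τ(λ[x']_p) = τ(λ) and σ(ρ) →* τ(ρ).  As x does not occur in γ, τ satisfies γ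
-- too, and since = does not depend on R a Th^CR-derivation of γ is already a derivation for
-- =_E; hence τ(λ) =_E τ(ρ).  If x still occurs in λ[x']_p (it occurs twice in λ), resp. in ρ,
-- the corresponding sequence has at least one step.
--
-- (2) Only unconditional equations are usable in ↔_E, so σ x = σ x' holds in Th^CR, and
-- congruence at the active position p gives σ(ℓ[x']_p) = σ(ℓ).  The →ps clause of α then
-- rewrites σ(ℓ[x']_p) to σ(r) in one step.  If ℓ is μ-left-linear, p is the only occurrence of
-- x, so σ(ℓ[x']_p) = τ(ℓ) → τ(r), and τ(r) =_E σ(r) because x occurs only actively in r.

module Submission where

open import Defs
open import Data.Nat using (ℕ; zero; suc; _≟_)
open import Data.Fin using (Fin; toℕ) renaming (zero to fzero; suc to fsuc)
open import Data.Fin.Properties using (toℕ-injective)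
open import Data.Fin.Subset using (Subset; inside; outside) renaming (_∈_ to _∈ₛ_; _∉_ to _∉ₛ_)
open import Data.Fin.Subset.Properties using (_∈?_; drop-there)
open import Data.Vec using (Vec; []; _∷_; lookup; tabulate; _[_]≔_; here; there)
open import Data.Vec.Properties using (tabulate-cong; tabulate∘lookup; []≔-lookup)
open import Data.List using (List; []; _∷_; map)
open import Data.List.Properties using (∷-injectiveˡ; ∷-injectiveʳ; ≡-dec)
open import Data.List.Membership.Propositional using (_∈_)
open import Data.List.Relation.Unary.All as All using (All; []; _∷_)
open import Data.List.Relation.Unary.All.Properties using (map⁺; map⁻)
open import Data.List.Relation.Unary.Any using (Any; here; there)
open import Data.List.Relation.Binary.Pointwise using (Pointwise; []; _∷_)
open import Data.Product using (_×_; _,_; proj₁; proj₂)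
open import Data.Empty using (⊥; ⊥-elim)
open import Data.Unit using (⊤; tt)
open import Function using (_∘_; id)
open import Relation.Nullary using (¬_; Dec; yes; no)
open import Relation.Binary.PropositionalEquality
open import Relation.Binary.Construct.Closure.ReflexiveTransitive using (Star; ε; _◅_; _◅◅_; gmap)
open import Relation.Binary.Construct.Closure.Transitive using (TransClosure; [_]; _∷_)

module _ {S : Sig} where

  lookup-·* : ∀ {n} (σ : Subst S) (ts : Vec (Term S) n) i → lookup (σ ·* ts) i ≡ σ · lookup ts i
  lookup-·* σ (t ∷ ts) fzero    = refl
  lookup-·* σ (t ∷ ts) (fsuc i) = lookup-·* σ ts i

  ·*-[]≔ : ∀ {n} (σ : Subst S) (ts : Vec (Term S) n) i t →
           σ ·* (ts [ i ]≔ t) ≡ (σ ·* ts) [ i ]≔ (σ · t)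
  ·*-[]≔ σ (u ∷ ts) fzero    t = refl
  ·*-[]≔ σ (u ∷ ts) (fsuc i) t = cong ((σ · u) ∷_) (·*-[]≔ σ ts i t)

  ·*-tabulate-var : ∀ {n} (σ : Subst S) (g : Fin n → ℕ) → σ ·* tabulate (var ∘ g) ≡ tabulate (σ ∘ g)
  ·*-tabulate-var {zero}  σ g = refl
  ·*-tabulate-var {suc n} σ g = cong (σ (g fzero) ∷_) (·*-tabulate-var σ (g ∘ fsuc))

  mutual
    ·-agree : (σ τ : Subst S) (t : Term S) → (∀ y → VarT t y → σ y ≡ τ y) → σ · t ≡ τ · t
    ·-agree σ τ (var x)    on-vars = on-vars x ([] , root)
    ·-agree σ τ (fun f ts) on-vars =
      cong (fun f) (·*-agree σ τ ts (λ i y (q , st) → on-vars y (toℕ i ∷ q , arg i st)))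

    ·*-agree : ∀ {n} (σ τ : Subst S) (ts : Vec (Term S) n) →
               (∀ i y → VarT (lookup ts i) y → σ y ≡ τ y) → σ ·* ts ≡ τ ·* ts
    ·*-agree σ τ []       on-vars = refl
    ·*-agree σ τ (t ∷ ts) on-vars =
      cong₂ _∷_ (·-agree σ τ t (on-vars fzero)) (·*-agree σ τ ts (on-vars ∘ fsuc))

  Any-argsV : ∀ {n} {P : Term S → Set} (ts : Vec (Term S) n) i → P (lookup ts i) → Any P (argsV ts)
  Any-argsV (t ∷ ts) fzero    pt = here pt
  Any-argsV (t ∷ ts) (fsuc i) pt = there (Any-argsV ts i pt)

  ·₂-agree : (σ τ : Subst S) (K : Term S → Term S → TAtom S) (s t : Term S) →
             (∀ y → Any (λ u → VarT u y) (s ∷ t ∷ []) → σ y ≡ τ y) →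
             K (σ · s) (σ · t) ≡ K (τ · s) (τ · t)
  ·₂-agree σ τ K s t on-vars =
    cong₂ K (·-agree σ τ s (λ y v → on-vars y (here v)))
            (·-agree σ τ t (λ y v → on-vars y (there (here v))))

  ·A-agree : (σ τ : Subst S) (A : TAtom S) → (∀ y → Any (λ t → VarT t y) (argsT A) → σ y ≡ τ y) →
             σ ·A A ≡ τ ·A A
  ·A-agree σ τ (eqT s t)    = ·₂-agree σ τ eqT s t
  ·A-agree σ τ (rwT s t)    = ·₂-agree σ τ rwT s t
  ·A-agree σ τ (rwsT s t)   = ·₂-agree σ τ rwsT s t
  ·A-agree σ τ (rwpsT s t)  = ·₂-agree σ τ rwpsT s t
  ·A-agree σ τ (rwspsT s t) = ·₂-agree σ τ rwspsT s t
  ·A-agree σ τ (rwrmT s t)  = ·₂-agree σ τ rwrmT s t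
  ·A-agree σ τ (rwsrmT s t) = ·₂-agree σ τ rwsrmT s t
  ·A-agree σ τ (pT p ts)   on-vars = cong (pT p) (·*-agree σ τ ts (λ i y → on-vars y ∘ Any-argsV ts i))
  ·A-agree σ τ (pTrm p ts) on-vars = cong (pTrm p) (·*-agree σ τ ts (λ i y → on-vars y ∘ Any-argsV ts i))

  holds-agree : ∀ {T : Clause S → Set} {σ θ : Subst S} {c : List (TAtom S)} →
                (∀ y → VarCond c y → σ y ≡ θ y) →
                All (λ A → T ⊢ (σ ·A A)) c → All (λ A → T ⊢ (θ ·A A)) c
  holds-agree {c = []}            on-vars []       = []
  holds-agree {T} {σ} {θ} {A ∷ c} on-vars (d ∷ ds) =
    subst (T ⊢_) (·A-agree σ θ A (λ y → on-vars y ∘ here)) d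
    ∷ holds-agree (λ y → on-vars y ∘ there) ds

  _[_↦_] : Subst S → ℕ → Term S → Subst S
  (σ [ x ↦ u ]) y with y ≟ x
  ... | yes _ = u
  ... | no _  = σ y

  [↦]-hit : ∀ σ x {u} → (σ [ x ↦ u ]) x ≡ u
  [↦]-hit σ x with x ≟ x
  ... | yes _   = refl
  ... | no x≢x = ⊥-elim (x≢x refl)

  [↦]-miss : ∀ σ {x u} y → y ≢ x → (σ [ x ↦ u ]) y ≡ σ y
  [↦]-miss σ {x} y y≢x with y ≟ x
  ... | yes y≡x = ⊥-elim (y≢x y≡x)
  ... | no _    = refl

  [↦]-outside : ∀ σ {x u} (P : ℕ → Set) → ¬ P x → ∀ y → P y → σ y ≡ (σ [ x ↦ u ]) y
  [↦]-outside σ P ¬Px y Py = sym ([↦]-miss σ y λ { refl → ¬Px Py })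

  [↦]-identifies : ∀ σ {x x'} → x ≢ x' → (σ [ x ↦ σ x' ]) x' ≡ (σ [ x ↦ σ x' ]) x
  [↦]-identifies σ {x} {x'} x≢x' = trans ([↦]-miss σ x' (x≢x' ∘ sym)) (sym ([↦]-hit σ x))

  SubtermAt-arg⁻ : ∀ {f : F S} {ts : Vec (Term S) (ar S f)} (i : Fin (ar S f)) {p} {u : Term S} →
                   SubtermAt (fun f ts) (toℕ i ∷ p) u → SubtermAt (lookup ts i) p u
  SubtermAt-arg⁻ {f} {ts} i {p} {u} st = go st refl
    where
    go : ∀ {q} → SubtermAt (fun f ts) q u → q ≡ toℕ i ∷ p → SubtermAt (lookup ts i) p u
    go root ()
    go (arg j st) q≡ with toℕ-injective (∷-injectiveˡ q≡) | ∷-injectiveʳ q≡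
    ... | refl | refl = st

  APos-arg⁻ : ∀ {μ : RMap S} {f : F S} {ts : Vec (Term S) (ar S f)} (i : Fin (ar S f)) {p} →
              APos μ (fun f ts) (toℕ i ∷ p) → i ∈ₛ μ f × APos μ (lookup ts i) p
  APos-arg⁻ {μ} {f} {ts} i {p} ap = go ap refl
    where
    go : ∀ {q} → APos μ (fun f ts) q → q ≡ toℕ i ∷ p → i ∈ₛ μ f × APos μ (lookup ts i) p
    go root ()
    go (arg j j∈ ap) q≡ with toℕ-injective (∷-injectiveˡ q≡) | ∷-injectiveʳ q≡
    ... | refl | refl = j∈ , ap

  APos? : ∀ (μ : RMap S) {t : Term S} {q u} → SubtermAt t q u → Dec (APos μ t q)
  APos? μ root = yes root
  APos? μ (arg {f} i st) with i ∈? μ f | APos? μ st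
  ... | yes i∈ | yes ap = yes (arg i i∈ ap)
  ... | no i∉  | _      = no λ ap → i∉ (proj₁ (APos-arg⁻ i ap))
  ... | yes _  | no ¬ap = no λ ap → ¬ap (proj₂ (APos-arg⁻ i ap))

  active-occurrence : ∀ {μ : RMap S} {t : Term S} {q x} → SubtermAt t q (var x) → ¬ VarN μ t x →
                      APos μ t q
  active-occurrence {μ} {q = q} st no-inactive with APos? μ st
  ... | yes ap  = ap
  ... | no ¬ap = ⊥-elim (no-inactive (q , st , ¬ap))

  SubtermAt-unique : ∀ {t : Term S} {p u v} → SubtermAt t p u → SubtermAt t p v → u ≡ v
  SubtermAt-unique root        root = refl
  SubtermAt-unique (arg i st) st'  = SubtermAt-unique st (SubtermAt-arg⁻ i st')

  var-≢ : ∀ {x x'} → x ≢ x' → ¬ VarT {S} (var x') x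
  var-≢ x≢x' (_ , root) = x≢x' refl

  fresh-≢ : ∀ {t : Term S} {p x x'} → SubtermAt t p (var x) → ¬ VarT t x' → x ≢ x'
  fresh-≢ {p = p} x-at-p x'∉t refl = x'∉t (p , x-at-p)

  replaceArg≡[]≔ : ∀ {n} (ts : Vec (Term S) n) (i : Fin n) p s →
                   replaceArg ts (toℕ i) p s ≡ ts [ i ]≔ replace (lookup ts i) p s
  replaceArg≡[]≔ (t ∷ ts) fzero    p s = refl
  replaceArg≡[]≔ (t ∷ ts) (fsuc i) p s = cong (t ∷_) (replaceArg≡[]≔ ts i p s)

  lookup-replaceArg : ∀ {n} (ts : Vec (Term S) n) (i : Fin n) p s →
                      lookup (replaceArg ts (toℕ i) p s) i ≡ replace (lookup ts i) p s
  lookup-replaceArg (t ∷ ts) fzero    p s = refl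
  lookup-replaceArg (t ∷ ts) (fsuc i) p s = lookup-replaceArg ts i p s

  lookup-replaceArg-miss : ∀ {n} (ts : Vec (Term S) n) (i : Fin n) j p s → toℕ i ≢ j →
                           lookup (replaceArg ts j p s) i ≡ lookup ts i
  lookup-replaceArg-miss (t ∷ ts) fzero    zero    p s i≢j = ⊥-elim (i≢j refl)
  lookup-replaceArg-miss (t ∷ ts) fzero    (suc j) p s i≢j = refl
  lookup-replaceArg-miss (t ∷ ts) (fsuc i) zero    p s i≢j = refl
  lookup-replaceArg-miss (t ∷ ts) (fsuc i) (suc j) p s i≢j =
    lookup-replaceArg-miss ts i j p s (i≢j ∘ cong suc)

  ·*-replaceArg : ∀ {n} (σ : Subst S) (ts : Vec (Term S) n) (i : Fin n) p s →
                  σ ·* replaceArg ts (toℕ i) p s ≡ (σ ·* ts) [ i ]≔ (σ · replace (lookup ts i) p s)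
  ·*-replaceArg σ ts i p s = trans (cong (σ ·*_) (replaceArg≡[]≔ ts i p s)) (·*-[]≔ σ ts i _)

  replace-SubtermAt : ∀ {t : Term S} {p u} s → SubtermAt t p u → SubtermAt (replace t p s) p s
  replace-SubtermAt s root = root
  replace-SubtermAt s (arg {ts = ts} {p} i st) =
    arg i (subst (λ w → SubtermAt w p s) (sym (lookup-replaceArg ts i p s)) (replace-SubtermAt s st))

  ·-replace : ∀ {t : Term S} {p x} (τ : Subst S) s → SubtermAt t p (var x) → τ · s ≡ τ x →
              τ · replace t p s ≡ τ · t
  ·-replace τ s root τs≡τx = τs≡τx
  ·-replace τ s (arg {f} {ts} {p} i st) τs≡τx = cong (fun f) (begin
    τ ·* replaceArg ts (toℕ i) p s                    ≡⟨ ·*-replaceArg τ ts i p s ⟩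
    (τ ·* ts) [ i ]≔ (τ · replace (lookup ts i) p s)  ≡⟨ cong (_ [ i ]≔_) (·-replace τ s st τs≡τx) ⟩
    (τ ·* ts) [ i ]≔ (τ · lookup ts i)                ≡⟨ cong (_ [ i ]≔_) (lookup-·* τ ts i) ⟨
    (τ ·* ts) [ i ]≔ lookup (τ ·* ts) i               ≡⟨ []≔-lookup (τ ·* ts) i ⟩
    τ ·* ts                                           ∎)
    where open ≡-Reasoning

  SubtermAt-replace⁻ : ∀ t p {s : Term S} {q y} → ¬ VarT s y →
                       SubtermAt (replace t p s) q (var y) → SubtermAt t q (var y)
  SubtermAt-replace⁻ t          []      y∉s st = ⊥-elim (y∉s (_ , st))
  SubtermAt-replace⁻ (var z)    (_ ∷ _) y∉s st = st
  SubtermAt-replace⁻ (fun f ts) (j ∷ p) {s} {y = y} y∉s (arg {p = q} i st) with toℕ i ≟ j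
  ... | yes refl = arg i (SubtermAt-replace⁻ (lookup ts i) p y∉s
                           (subst (λ w → SubtermAt w q (var y)) (lookup-replaceArg ts i p s) st))
  ... | no i≢j   =
    arg i (subst (λ w → SubtermAt w q (var y)) (lookup-replaceArg-miss ts i j p s i≢j) st)

  APos-replace⁺ : ∀ {μ : RMap S} t p {s : Term S} {q y} → ¬ VarT s y →
                  SubtermAt (replace t p s) q (var y) → APos μ t q → APos μ (replace t p s) q
  APos-replace⁺ t          []      y∉s st = ⊥-elim (y∉s (_ , st))
  APos-replace⁺ (var z)    (_ ∷ _) y∉s st = id
  APos-replace⁺ {μ} (fun f ts) (j ∷ p) {s} {y = y} y∉s (arg {p = q} i st) ap
    with APos-arg⁻ i ap | toℕ i ≟ j
  ... | i∈ , ap' | yes refl =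
    arg i i∈ (subst (λ w → APos μ w q) (sym (lookup-replaceArg ts i p s))
               (APos-replace⁺ (lookup ts i) p y∉s
                 (subst (λ w → SubtermAt w q (var y)) (lookup-replaceArg ts i p s) st) ap'))
  ... | i∈ , ap' | no i≢j =
    arg i i∈ (subst (λ w → APos μ w q) (sym (lookup-replaceArg-miss ts i j p s i≢j)) ap')

  VarN-replace⁻ : ∀ {μ : RMap S} {t p} {s : Term S} {y} → ¬ VarT s y →
                  VarN μ (replace t p s) y → VarN μ t y
  VarN-replace⁻ {t = t} {p} y∉s (q , st , inactive) =
    q , SubtermAt-replace⁻ t p y∉s st , inactive ∘ APos-replace⁺ t p y∉s st

  SubtermAt-replace⁺ : ∀ {t : Term S} {p q x y} s → SubtermAt t p (var x) → SubtermAt t q (var y) →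
                       q ≢ p → SubtermAt (replace t p s) q (var y)
  SubtermAt-replace⁺ s root root q≢p = ⊥-elim (q≢p refl)
  SubtermAt-replace⁺ s (arg {ts = ts} {p} i st₁) (arg {p = q} k st₂) q≢p with toℕ k ≟ toℕ i
  ... | yes k≡i with toℕ-injective k≡i
  ...   | refl = arg i (subst (λ w → SubtermAt w q _) (sym (lookup-replaceArg ts i p s))
                         (SubtermAt-replace⁺ s st₁ st₂ (q≢p ∘ cong (toℕ i ∷_))))
  SubtermAt-replace⁺ s (arg {ts = ts} {p} i st₁) (arg {p = q} k st₂) q≢p | no k≢i =
    arg k (subst (λ w → SubtermAt w q _) (sym (lookup-replaceArg-miss ts k (toℕ i) p s k≢i)) st₂)

  twice-replace : ∀ {t : Term S} {p x} s → OccursMoreThanOnce x t → SubtermAt t p (var x) →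
                  VarT (replace t p s) x
  twice-replace {p = p} s (p₁ , p₂ , p₁≢p₂ , x-at-p₁ , x-at-p₂) x-at-p with ≡-dec _≟_ p₁ p
  ... | yes refl = p₂ , SubtermAt-replace⁺ s x-at-p x-at-p₂ (p₁≢p₂ ∘ sym)
  ... | no p₁≢p  = p₁ , SubtermAt-replace⁺ s x-at-p x-at-p₁ p₁≢p

  unique-replace : ∀ {t : Term S} {p x s} → (∀ q → SubtermAt t q (var x) → q ≡ p) →
                   SubtermAt t p (var x) → ¬ VarT s x → ¬ VarT (replace t p s) x
  unique-replace {t} {p} {x} {s} only-at-p x-at-p x∉s (q , st)
    with only-at-p q (SubtermAt-replace⁻ t p x∉s st)
  ... | refl = x∉s ([] , subst (λ w → SubtermAt w [] (var x)) x≡s root)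
    where
    x≡s : var x ≡ s
    x≡s = SubtermAt-unique st (replace-SubtermAt s x-at-p)

  record μMonotonic (μ : RMap S) (_~_ : Term S → Term S → Set) : Set where
    field
      arg-cong : ∀ f (i : Fin (ar S f)) → i ∈ₛ μ f →
                 ∀ us u → lookup us i ~ u → fun f us ~ fun f (us [ i ]≔ u)

  _◅⁺_ : ∀ {_~_ : Term S → Term S → Set} {s t u} → s ~ t → Star _~_ t u → TransClosure _~_ s u
  s~t ◅⁺ ε          = [ s~t ]
  s~t ◅⁺ (t~ ◅ ~u) = s~t ∷ (t~ ◅⁺ ~u)

  star-context : ∀ {_~_ : Term S → Term S → Set} {n} (C : Vec (Term S) n → Term S) (A : Subset n) →
                 (∀ i → i ∈ₛ A → ∀ us u → lookup us i ~ u → C us ~ C (us [ i ]≔ u)) →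
                 ∀ us vs → (∀ i → i ∈ₛ A → Star _~_ (lookup us i) (lookup vs i)) →
                 (∀ i → i ∉ₛ A → lookup us i ≡ lookup vs i) → Star _~_ (C us) (C vs)
  star-context C []           closed []       []       act inact = ε
  star-context C (inside ∷ A) closed (u ∷ us) (v ∷ vs) act inact =
    gmap (λ w → C (w ∷ us)) (λ {w} {w'} → closed fzero here (w ∷ us) w') (act fzero here)
    ◅◅ star-context (λ ws → C (v ∷ ws)) A (λ i i∈ ws → closed (fsuc i) (there i∈) (v ∷ ws)) us vs
         (λ i i∈ → act (fsuc i) (there i∈)) (λ i i∉ → inact (fsuc i) (i∉ ∘ drop-there))
  star-context {_~_} C (outside ∷ A) closed (u ∷ us) (v ∷ vs) act inact =
    subst (λ w → Star _~_ (C (u ∷ us)) (C (w ∷ vs))) (inact fzero λ ())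
      (star-context (λ ws → C (u ∷ ws)) A (λ i i∈ ws → closed (fsuc i) (there i∈) (u ∷ ws)) us vs
         (λ i i∈ → act (fsuc i) (there i∈)) (λ i i∉ → inact (fsuc i) (i∉ ∘ drop-there)))

  module _ {μ : RMap S} {_~_ : Term S → Term S → Set} (mono : μMonotonic μ _~_) where
    open μMonotonic mono

    replace-active : ∀ (σ : Subst S) {t p u} s → APos μ t p → SubtermAt t p u → (σ · u) ~ (σ · s) →
                     (σ · t) ~ (σ · replace t p s)
    replace-active σ s _  root r = r
    replace-active σ s ap (arg {f} {ts} {p} i st) r with APos-arg⁻ i ap
    ... | i∈ , ap' =
      subst (λ us → fun f (σ ·* ts) ~ fun f us) (sym (·*-replaceArg σ ts i p s))
        (arg-cong f i i∈ (σ ·* ts) _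
          (subst (_~ (σ · replace (lookup ts i) p s)) (sym (lookup-·* σ ts i))
            (replace-active σ s ap' st r)))

    mutual
      star-· : ∀ (σ τ : Subst S) t → (∀ y → VarT t y → Star _~_ (σ y) (τ y)) →
               (∀ y → VarN μ t y → σ y ≡ τ y) → Star _~_ (σ · t) (τ · t)
      star-· σ τ (var y)    act inact = act y ([] , root)
      star-· σ τ (fun f ts) act inact = star-context (fun f) (μ f) (arg-cong f) (σ ·* ts) (τ ·* ts)
        (λ i _ → star-·* σ τ ts (λ j y (q , st) → act y (toℕ j ∷ q , arg j st))
                   (λ j y (q , st , ¬ap) →
                      inact y (toℕ j ∷ q , arg j st , λ ap → ¬ap (proj₂ (APos-arg⁻ j ap)))) i)
        (λ i i∉ → begin
          lookup (σ ·* ts) i  ≡⟨ lookup-·* σ ts i ⟩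
          σ · lookup ts i     ≡⟨ ·-agree σ τ (lookup ts i) (λ y (q , st) →
                                   inact y (toℕ i ∷ q , arg i st , λ ap → i∉ (proj₁ (APos-arg⁻ i ap)))) ⟩
          τ · lookup ts i     ≡⟨ lookup-·* τ ts i ⟨
          lookup (τ ·* ts) i  ∎)
        where open ≡-Reasoning

      star-·* : ∀ (σ τ : Subst S) {n} (ts : Vec (Term S) n) →
                (∀ i y → VarT (lookup ts i) y → Star _~_ (σ y) (τ y)) →
                (∀ i y → VarN μ (lookup ts i) y → σ y ≡ τ y) →
                ∀ i → Star _~_ (lookup (σ ·* ts) i) (lookup (τ ·* ts) i)
      star-·* σ τ (t ∷ ts) act inact fzero    = star-· σ τ t (act fzero) (inact fzero)
      star-·* σ τ (t ∷ ts) act inact (fsuc i) = star-·* σ τ ts (act ∘ fsuc) (inact ∘ fsuc) i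

    star-·-update : ∀ σ {x u} t → σ x ~ u → ¬ VarN μ t x → Star _~_ (σ · t) ((σ [ x ↦ u ]) · t)
    star-·-update σ {x} {u} t σx~u no-inactive = star-· σ (σ [ x ↦ u ]) t act inact
      where
      act : ∀ y → VarT t y → Star _~_ (σ y) ((σ [ x ↦ u ]) y)
      act y _ with y ≟ x
      ... | yes refl = σx~u ◅ ε
      ... | no _     = ε
      inact : ∀ y → VarN μ t y → σ y ≡ (σ [ x ↦ u ]) y
      inact = [↦]-outside σ (VarN μ t) no-inactive

    plus-·-update : ∀ σ {x x'} t → x ≢ x' → σ x ~ σ x' → VarT t x → ¬ VarN μ t x →
                    TransClosure _~_ (σ · t) ((σ [ x ↦ σ x' ]) · t)
    plus-·-update σ {x} {x'} t x≢x' σx~σx' (q , x-at-q) no-inactive =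
      replace-active σ (var x') (active-occurrence x-at-q no-inactive) x-at-q σx~σx'
      ◅⁺ subst (Star _~_ _) (·-replace (σ [ x ↦ σ x' ]) (var x') x-at-q ([↦]-identifies σ x≢x'))
           (star-·-update σ (replace t q (var x')) σx~σx' (no-inactive ∘ VarN-replace⁻ (var-≢ x≢x')))

  vecSubst : ∀ {n} → Vec (Term S) n → Term S → Subst S
  vecSubst []       u _       = u
  vecSubst (t ∷ ts) u zero    = t
  vecSubst (t ∷ ts) u (suc m) = vecSubst ts u m

  vecSubst-lookup : ∀ {n} (ts : Vec (Term S) n) u i → vecSubst ts u (toℕ i) ≡ lookup ts i
  vecSubst-lookup (t ∷ ts) u fzero    = refl
  vecSubst-lookup (t ∷ ts) u (fsuc i) = vecSubst-lookup ts u i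

  vecSubst-beyond : ∀ {n} (ts : Vec (Term S) n) u → vecSubst ts u n ≡ u
  vecSubst-beyond []       u = refl
  vecSubst-beyond (t ∷ ts) u = vecSubst-beyond ts u

  vecSubst-args : ∀ {n} (ts : Vec (Term S) n) u → vecSubst ts u ·* tabulate (var ∘ toℕ) ≡ ts
  vecSubst-args ts u =
    trans (·*-tabulate-var (vecSubst ts u) toℕ)
          (trans (tabulate-cong (vecSubst-lookup ts u)) (tabulate∘lookup ts))

  ⊢-monotonic : ∀ {T : Clause S → Set} {μ : RMap S} (K : Term S → Term S → TAtom S) →
                (∀ σ s t → σ ·A K s t ≡ K (σ · s) (σ · t)) →
                (∀ f (i : Fin (ar S f)) → i ∈ₛ μ f →
                   T (K (fun f (tabulate (var ∘ toℕ)))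
                        (fun f (tabulate (var ∘ toℕ) [ i ]≔ var (ar S f)))
                      ⇐ᶜ (K (var (toℕ i)) (var (ar S f)) ∷ []))) →
                μMonotonic μ (λ s t → T ⊢ K s t)
  μMonotonic.arg-cong (⊢-monotonic {T} K K-· clause) f i i∈ us u d =
    subst₂ (λ s t → T ⊢ K s t) (cong (fun f) (vecSubst-args us u)) (cong (fun f) θ-args[i]≔)
      (subst (T ⊢_) (K-· θ _ _)
        (inst (clause f i i∈) θ (subst (T ⊢_) (sym (K-· θ _ _)) θ-premise ∷ [])))
    where
    θ = vecSubst us u
    θ-premise : T ⊢ K (θ (toℕ i)) (θ (ar S f))
    θ-premise = subst₂ (λ s t → T ⊢ K s t) (sym (vecSubst-lookup us u i)) (sym (vecSubst-beyond us u)) d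
    θ-args[i]≔ : θ ·* (tabulate (var ∘ toℕ) [ i ]≔ var (ar S f)) ≡ us [ i ]≔ u
    θ-args[i]≔ =
      trans (·*-[]≔ θ _ i _) (cong₂ (λ vs w → vs [ i ]≔ w) (vecSubst-args us u) (vecSubst-beyond us u))

module _ {S : Sig} (ℛ : EGTRS S) where
  open EGTRS ℛ

  module _ {T : Clause S → Set} (embed : ∀ {cl} → ThA ℛ cl → T cl) where

    ≐-refl : ∀ s → T ⊢ eqT s s
    ≐-refl s = inst (embed eq-refl) (vecSubst [] s) []

    ≐-sym : ∀ {s t} → T ⊢ eqT s t → T ⊢ eqT t s
    ≐-sym {s} {t} d = inst (embed eq-sym) (vecSubst (s ∷ []) t) (d ∷ [])

    ≐-trans : ∀ {s t u} → T ⊢ eqT s t → T ⊢ eqT t u → T ⊢ eqT s u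
    ≐-trans {s} {t} {u} d d' = inst (embed eq-trans) (vecSubst (s ∷ t ∷ []) u) (d ∷ d' ∷ [])

    star⇒≐ : ∀ {s t} → Star (λ u v → T ⊢ eqT u v) s t → T ⊢ eqT s t
    star⇒≐ ε        = ≐-refl _
    star⇒≐ (d ◅ ds) = ≐-trans d (star⇒≐ ds)

  ≐-monotonic : μMonotonic μ (λ s t → ThCR ℛ ⊢ eqT s t)
  ≐-monotonic = ⊢-monotonic eqT (λ _ _ _ → refl) (λ f i i∈ → a (eq-cong f i i∈))

  →R-monotonic : μMonotonic μ (_→R_ ℛ)
  →R-monotonic = ⊢-monotonic rwT (λ _ _ _ → refl) rw-cong

  Independent : TAtom S → Set
  Independent (eqT _ _) = ⊤
  Independent (pT p _)  = ¬ DependsR E H (usrΠ p)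
  Independent _         = ⊥

  plain-independent : ∀ σ A → ¬ DependsR E H (predOf A) → Independent (σ ·A plain A)
  plain-independent σ (s ≐ t)     _     = tt
  plain-independent σ (s ⇝ t)     indep = ⊥-elim (indep dep-rw)
  plain-independent σ (s ⇝* t)    indep = ⊥-elim (indep dep-rws)
  plain-independent σ (papp p ts) indep = indep

  E-conditions-independent : ∀ {s t c} → E (s ≐ t ⇐ c) → All (λ A → ¬ DependsR E H (predOf A)) c
  E-conditions-independent e = All.tabulate λ A∈c dep → eq-indep (dep-E e A∈c dep)

  H-body-independent : ∀ {p ts b} → H (hclause p ts b) → ¬ DependsR E H (usrΠ p) →
                       All (λ A → ¬ DependsR E H (predOf A)) b
  H-body-independent h∈H indep = All.tabulate λ A∈b dep → indep (dep-H h∈H A∈b dep)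

  mutual
    ThCR-conservative : ∀ {A} → ThCR ℛ ⊢ A → Independent A → ThEq ℛ ⊢ A
    ThCR-conservative (inst (a eq-refl) σ []) _ = inst (a eq-refl) σ []
    ThCR-conservative (inst (a eq-sym) σ (d ∷ [])) _ = inst (a eq-sym) σ (ThCR-conservative d tt ∷ [])
    ThCR-conservative (inst (a eq-trans) σ (d ∷ d' ∷ [])) _ =
      inst (a eq-trans) σ (ThCR-conservative d tt ∷ ThCR-conservative d' tt ∷ [])
    ThCR-conservative (inst (a (eq-cong f i i∈)) σ (d ∷ [])) _ =
      inst (a (eq-cong f i i∈)) σ (ThCR-conservative d tt ∷ [])
    ThCR-conservative (inst (a (eq-E e)) σ ds) _ =
      inst (a (eq-E e)) σ (conserve-conditions σ (E-conditions-independent e) ds)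
    ThCR-conservative (inst (h-rm h∈H (rm-ndep indep) rm-body) σ ds) _ =
      inst (h h∈H) σ (conserve-body σ rm-body (H-body-independent h∈H indep) ds)
    ThCR-conservative (inst (h-rm _ (rm-dep _) _) _ _) ()
    ThCR-conservative (inst rws-refl _ _) ()
    ThCR-conservative (inst rws-step _ _) ()
    ThCR-conservative (inst (rw-cong _ _ _) _ _) ()
    ThCR-conservative (inst (rw-rule _) _ _) ()
    ThCR-conservative (inst rwsps-refl _ _) ()
    ThCR-conservative (inst rwsps-step _ _) ()
    ThCR-conservative (inst (rwps-cong _ _ _) _ _) ()
    ThCR-conservative (inst (rwps-rule _ _ _ _ _) _ _) ()
    ThCR-conservative (inst rwsrm-refl _ _) ()
    ThCR-conservative (inst rwsrm-step _ _) ()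
    ThCR-conservative (inst rwrm-def _ _) ()

    conserve-conditions : ∀ σ {c} → All (λ A → ¬ DependsR E H (predOf A)) c →
                          All (ThCR ℛ ⊢_) (map (σ ·A_) (map plain c)) →
                          All (ThEq ℛ ⊢_) (map (σ ·A_) (map plain c))
    conserve-conditions σ []             []       = []
    conserve-conditions σ (indep ∷ inds) (d ∷ ds) =
      ThCR-conservative d (plain-independent σ _ indep) ∷ conserve-conditions σ inds ds

    conserve-body : ∀ σ {b b'} → Pointwise (RmAtom ℛ) b b' → All (λ A → ¬ DependsR E H (predOf A)) b →
                    All (ThCR ℛ ⊢_) (map (σ ·A_) b') → All (ThEq ℛ ⊢_) (map (σ ·A_) (map plain b))
    conserve-body σ []                     []          []       = []
    conserve-body σ (rm-eq ∷ rm-b)         (_ ∷ inds)  (d ∷ ds) =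
      ThCR-conservative d tt ∷ conserve-body σ rm-b inds ds
    conserve-body σ (rm-ndep indep ∷ rm-b) (_ ∷ inds)  (d ∷ ds) =
      ThCR-conservative d indep ∷ conserve-body σ rm-b inds ds
    conserve-body σ (rm-rw ∷ _)            (indep ∷ _) _        = ⊥-elim (indep dep-rw)
    conserve-body σ (rm-rws ∷ _)           (indep ∷ _) _        = ⊥-elim (indep dep-rws)
    conserve-body σ (rm-dep dep ∷ _)       (indep ∷ _) _        = ⊥-elim (indep dep)

  ↔Sound : TAtom S → Set
  ↔Sound (rwT s t)  = ThCR ℛ ⊢ eqT s t
  ↔Sound (rwsT s t) = ThCR ℛ ⊢ eqT s t
  ↔Sound _          = ⊥

  -- Only unconditional equations apply in ↔E: its theory has no clauses for = or user
  -- predicates, and a → or →* condition would make = depend on R.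
  E-condition-fails : ∀ {s t c} → E (s ≐ t ⇐ c) → ∀ {A} → A ∈ c → ∀ σ → ¬ ↔Sound (σ ·A plain A)
  E-condition-fails e {_ ≐ _}    _   σ ()
  E-condition-fails e {_ ⇝ _}    A∈c σ _ = eq-indep (dep-E e A∈c dep-rw)
  E-condition-fails e {_ ⇝* _}   A∈c σ _ = eq-indep (dep-E e A∈c dep-rws)
  E-condition-fails e {papp _ _} _   σ ()

  ThSym-sound : ∀ {A} → ThSym ℛ ⊢ A → ↔Sound A
  ThSym-sound (inst rws-refl σ [])                = ≐-refl a _
  ThSym-sound (inst rws-step σ (d ∷ d' ∷ []))     = ≐-trans a (ThSym-sound d) (ThSym-sound d')
  ThSym-sound (inst (rw-cong f i i∈) σ (d ∷ []))  = inst (a (eq-cong f i i∈)) σ (ThSym-sound d ∷ [])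
  ThSym-sound (inst (rw-E (fwd {c = []} e)) σ []) = inst (a (eq-E e)) σ []
  ThSym-sound (inst (rw-E (bwd {c = []} e)) σ []) = ≐-sym a (inst (a (eq-E e)) σ [])
  ThSym-sound (inst (rw-E (fwd {c = _ ∷ _} e)) σ (d ∷ _)) =
    ⊥-elim (E-condition-fails e (here refl) σ (ThSym-sound d))
  ThSym-sound (inst (rw-E (bwd {c = _ ∷ _} e)) σ (d ∷ _)) =
    ⊥-elim (E-condition-fails e (here refl) σ (ThSym-sound d))

  ↔E⇒≐ : ∀ {s t} → _↔E_ ℛ s t → ThCR ℛ ⊢ eqT s t
  ↔E⇒≐ = ThSym-sound

  equation-=E : ∀ {lam rho γ} σ → InSymE ℛ lam rho γ → All (λ A → ThCR ℛ ⊢ (σ ·A A)) (map plain γ) →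
                _=E_ ℛ (σ · lam) (σ · rho)
  equation-=E σ (fwd e) γ-holds =
    inst (a (eq-E e)) σ (conserve-conditions σ (E-conditions-independent e) (map⁺ γ-holds))
  equation-=E σ (bwd e) γ-holds =
    ≐-sym a (inst (a (eq-E e)) σ (conserve-conditions σ (E-conditions-independent e) (map⁺ γ-holds)))

  →R-root : ∀ {l r c} σ → InRrm ℛ l r c → All (λ A → ThCR ℛ ⊢ (σ ·A A)) c →
            _→R_ ℛ (σ · l) (σ · r)
  →R-root σ α c-holds = inst (rw-rule α) σ (map⁺ c-holds)

  →RE-root : ∀ {l r c z} σ {s} → InRrm ℛ l r c → FreshFor ℛ z l r c →
             All (λ A → ThCR ℛ ⊢ (σ ·A A)) c → ThCR ℛ ⊢ eqT s (σ · l) → _→RE_ ℛ s (σ · r)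
  →RE-root {l} {r} {c} {z} σ {s} α (z∉l , z∉r , z∉c) c-holds s≐σl =
    subst₂ (λ u v → ThCR ℛ ⊢ rwpsT u v)
      ([↦]-hit σ z) (sym (·-agree σ θ r ([↦]-outside σ (VarT r) z∉r)))
      (inst (rwps-rule α z z∉l z∉r z∉c) θ
        (θz≐θl ∷ map⁺ (holds-agree ([↦]-outside σ (VarCond c) z∉c) c-holds)))
    where
    θ = σ [ z ↦ s ]
    θz≐θl : ThCR ℛ ⊢ eqT (θ z) (θ · l)
    θz≐θl = subst₂ (λ u v → ThCR ℛ ⊢ eqT u v)
              (sym ([↦]-hit σ z)) (·-agree σ θ l ([↦]-outside σ (VarT l) z∉l)) s≐σl

  πRw-joinable : ∀ {lam rho γ x p x'} → InSymE ℛ lam rho γ → PosVarA μ x lam p → ¬ VarT lam x' →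
                 μHomogeneous μ lam → μCompatible ℛ lam rho (map plain γ) →
                 Joinable ℛ (_→R_ ℛ) (πRw ℛ lam rho γ x p x')
                 × (OccursMoreThanOnce x lam → LeftStrictlyJoinable ℛ (_→R_ ℛ) (πRw ℛ lam rho γ x p x'))
                 × (VarT rho x → RightStrictlyJoinable ℛ (_→R_ ℛ) (πRw ℛ lam rho γ x p x'))
  πRw-joinable {lam} {rho} {γ} {x} {p} {x'} β (x-active , x-at-p) x'∉lam homogeneous
               (active-stays-active , active-not-in-cond) =
    meet ⇒* ⇒* left-star right-star ,
    (λ twice → meet ⇒⁺ ⇒* (left-plus (twice-replace (var x') twice x-at-p)) right-star) ,
    (λ x∈rho → meet ⇒* ⇒⁺ left-star (right-plus x∈rho))
    where
    t' = replace lam p (var x')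

    x∈lam : VarA μ lam x
    x∈lam = p , x-active , x-at-p

    x≢x' : x ≢ x'
    x≢x' = fresh-≢ x-at-p x'∉lam

    t'-active : ¬ VarN μ t' x
    t'-active = homogeneous x x∈lam ∘ VarN-replace⁻ (var-≢ x≢x')

    rho-active : ¬ VarN μ rho x
    rho-active = active-stays-active x x∈lam

    ⇒* ⇒⁺ : Term S → Term S → Set
    ⇒* = Star (_→R_ ℛ)
    ⇒⁺ = TransClosure (_→R_ ℛ)

    Towards : (Term S → Term S → Set) → Term S → Set
    Towards _⇒_ t = ∀ σ → _→R_ ℛ (σ x) (σ x') → (σ · t) ⇒ ((σ [ x ↦ σ x' ]) · t)

    meet : ∀ L Rr → Towards L t' → Towards Rr rho → JoinWith ℛ (_→R_ ℛ) L Rr (πRw ℛ lam rho γ x p x')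
    meet _ _ left right σ (σx→σx' ∷ γ-holds) =
      τ · t' , τ · rho , left σ σx→σx' , right σ σx→σx' ,
      subst (λ u → _=E_ ℛ u (τ · rho)) (sym (·-replace τ (var x') x-at-p ([↦]-identifies σ x≢x')))
        (equation-=E τ β (holds-agree τ-agrees (map⁺ (map⁻ γ-holds))))
      where
      τ = σ [ x ↦ σ x' ]
      τ-agrees : ∀ y → VarCond (map plain γ) y → σ y ≡ τ y
      τ-agrees = [↦]-outside σ (VarCond (map plain γ)) (active-not-in-cond x x∈lam)

    left-star : Towards ⇒* t'
    left-star σ σx→σx' = star-·-update →R-monotonic σ t' σx→σx' t'-active

    right-star : Towards ⇒* rho
    right-star σ σx→σx' = star-·-update →R-monotonic σ rho σx→σx' rho-active

    left-plus : VarT t' x → Towards ⇒⁺ t'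
    left-plus x∈t' σ σx→σx' = plus-·-update →R-monotonic σ t' x≢x' σx→σx' x∈t' t'-active

    right-plus : VarT rho x → Towards ⇒⁺ rho
    right-plus x∈rho σ σx→σx' = plus-·-update →R-monotonic σ rho x≢x' σx→σx' x∈rho rho-active

  -- x' is fresh for α, so it can serve as the variable of the →ps clause of α.
  πSym-left-strictly-joinable-modulo : ∀ {l r c x p x'} → InRrm ℛ l r c → PosVarA μ x l p →
                                       FreshFor ℛ x' l r c →
                                       LeftStrictlyJoinable ℛ (_→RE_ ℛ) (πSym ℛ l r c x p x')
  πSym-left-strictly-joinable-modulo {r = r} {x' = x'} α (x-active , x-at-p) x'-fresh
                                     σ (σx↔σx' ∷ c-holds) =
    σ · r , σ · r , [ →RE-root σ α x'-fresh (map⁻ c-holds) (≐-sym a σl≐σt') ] , ε , ≐-refl a (σ · r)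
    where
    σl≐σt' = replace-active ≐-monotonic σ (var x') x-active x-at-p (↔E⇒≐ σx↔σx')

  πSym-left-strictly-joinable : ∀ {l r c x p x'} → InRrm ℛ l r c → PosVarA μ x l p → ¬ VarT l x' →
                                μCompatible ℛ l r c → μLinear μ l →
                                LeftStrictlyJoinable ℛ (_→R_ ℛ) (πSym ℛ l r c x p x')
  πSym-left-strictly-joinable {l} {r} {c} {x} {p} {x'} α (x-active , x-at-p) x'∉l
                              (active-stays-active , active-not-in-cond) linear σ (σx↔σx' ∷ c-holds) =
    θ · r , σ · r , [ subst (λ u → _→R_ ℛ u (θ · r)) θl≡σt' (→R-root θ α θ-satisfies-c) ] , ε , θr=σr
    where
    θ = σ [ x ↦ σ x' ]
    t' = replace l p (var x')

    x∈l : VarA μ l x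
    x∈l = p , x-active , x-at-p

    x≢x' : x ≢ x'
    x≢x' = fresh-≢ x-at-p x'∉l

    x∉t' : ¬ VarT t' x
    x∉t' = unique-replace (λ q x-at-q → linear x x∈l q p x-at-q x-at-p) x-at-p (var-≢ x≢x')

    θl≡σt' : θ · l ≡ σ · t'
    θl≡σt' = trans (sym (·-replace θ (var x') x-at-p ([↦]-identifies σ x≢x')))
                   (·-agree θ σ t' (λ y y∈t' → sym ([↦]-outside σ (VarT t') x∉t' y y∈t')))

    θ-satisfies-c : All (λ A → ThCR ℛ ⊢ (θ ·A A)) c
    θ-satisfies-c = holds-agree ([↦]-outside σ (VarCond c) (active-not-in-cond x x∈l)) (map⁻ c-holds)

    σr≐θr : ThCR ℛ ⊢ eqT (σ · r) (θ · r)
    σr≐θr = star⇒≐ a (star-·-update ≐-monotonic σ r (↔E⇒≐ σx↔σx') (active-stays-active x x∈l))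

    θr=σr : _=E_ ℛ (θ · r) (σ · r)
    θr=σr = ≐-sym a (ThCR-conservative σr≐θr tt)

corollary8p19 : (S : Sig) (ℛ : EGTRS S) →
    -- (1) β : λ → ρ ⇐ γ ∈ ↔E
    (∀ (lam rho : Term S) (γ : List (CAtom S)) → InSymE ℛ lam rho γ →
      ∀ (x : ℕ) (p : Pos) (x' : ℕ) →
      PosVarA (EGTRS.μ ℛ) x lam p →
      FreshFor ℛ x' lam rho (map plain γ) →
      μHomogeneous (EGTRS.μ ℛ) lam →
      μCompatible ℛ lam rho (map plain γ) →
      Joinable ℛ (_→R_ ℛ) (πRw ℛ lam rho γ x p x')
      × (OccursMoreThanOnce x lam →
           LeftStrictlyJoinable ℛ (_→R_ ℛ) (πRw ℛ lam rho γ x p x'))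
      × (VarT rho x →
           RightStrictlyJoinable ℛ (_→R_ ℛ) (πRw ℛ lam rho γ x p x')))
    ×
    -- (2) α : ℓ → r ⇐ c ∈ R^rm
    (∀ (l r : Term S) (c : List (TAtom S)) → InRrm ℛ l r c →
      ∀ (x : ℕ) (p : Pos) (x' : ℕ) →
      PosVarA (EGTRS.μ ℛ) x l p →
      FreshFor ℛ x' l r c →
      μHomogeneous (EGTRS.μ ℛ) l →
      μCompatible ℛ l r c →
      LeftStrictlyJoinable ℛ (_→RE_ ℛ) (πSym ℛ l r c x p x')
      × (μLinear (EGTRS.μ ℛ) l →
           LeftStrictlyJoinable ℛ (_→R_ ℛ) (πSym ℛ l r c x p x')))
corollary8p19 S ℛ =
  (λ lam rho γ β x p x' x-pos (x'∉lam , _) homogeneous compatible →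
     πRw-joinable ℛ β x-pos x'∉lam homogeneous compatible) ,
  (λ l r c α x p x' x-pos x'-fresh _ compatible →
     πSym-left-strictly-joinable-modulo ℛ α x-pos x'-fresh ,
     πSym-left-strictly-joinable ℛ α x-pos (proj₁ x'-fresh) compatible)
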